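{- Let $p$ be a prime and write $Y_2(n)=\int_{\mathbb{Z}_p}x^{(n)}\,d\mu_1(x)$. For every integer $n\ge1$, $$Y_2(n+1)-nY_2(n)=\sum_{k=1}^{n}(-1)^{k+1}|L(n,k)|\frac{k!}{k^2+3k+2}.$$
   Context: The Volkenborn integral of a polynomial function $f:\mathbb{Z}_p\to\mathbb{Q}_p$ is $\int_{\mathbb{Z}_p}f(x)\,d\mu_1(x)=\lim_{N\to\infty}p^{ -N}\sum_{x=0}^{p^N-1}f(x)$. The rising factorial is $x^{(n)}=x(x+1)\cdots(x+n-1)$, $x^{(0)}=1$. The unsigned Lah numbers are $|L(n,k)|=\frac{n!}{k!}\binom{n-1}{k-1}$ for $1\le k\le n$. -}

module Defs where

open import Data.Nat as ℕ using (ℕ; zero; suc; _^_; _≤_; _∸_; NonZero; _!)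
open import Data.Nat.Combinatorics using (_C_)
open import Data.Nat.Divisibility using (_∣_)
open import Data.Nat.Primality using (Prime; prime⇒nonZero)
open import Data.Nat.Properties using (m^n≢0; _!≢0)
open import Data.Integer as ℤ using (ℤ; +_)
open import Data.Rational as ℚ using (ℚ; _-_; _+_; _*_; ↥_)
open import Data.Product using (∃-syntax)

rising : ℕ → ℕ → ℕ
rising x zero    = 1
rising x (suc n) = rising x n ℕ.* (x ℕ.+ n)

sumBelow : ℕ → (ℕ → ℕ) → ℕ
sumBelow zero    f = 0
sumBelow (suc m) f = sumBelow m f ℕ.+ f m

sum1to : ℕ → (ℕ → ℚ) → ℚ
sum1to zero    g = ℚ.0ℚ
sum1to (suc n) g = sum1to n g + g (suc n)

riemann : (p : ℕ) → Prime p → (ℕ → ℕ) → ℕ → ℚ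
riemann p pp f N = (+ sumBelow (p ^ N) f) ℚ./ (p ^ N)
  where
  instance
    _ = prime⇒nonZero pp
    _ = m^n≢0 p N

-- v_p(q) ≥ M  (for M ∈ ℕ): p^M divides the numerator of q in lowest terms
-- (q = 0 satisfies this for every M)
pSmall : ℕ → ℕ → ℚ → Set
pSmall p M q = p ^ M ∣ ℤ.∣ ↥ q ∣

-- ∫_{ℤ_p} f dμ₁ = L : the Riemann sums converge p-adically to L
VolkenbornIntegral : (p : ℕ) → Prime p → (ℕ → ℕ) → ℚ → Set
VolkenbornIntegral p pp f L =
  ∀ (M : ℕ) → ∃[ N₀ ] (∀ (N : ℕ) → N₀ ≤ N → pSmall p M (riemann p pp f N - L))

-- unsigned Lah number |L(n,k)| = n!/k! * C(n-1, k-1)   (for 1 ≤ k ≤ n)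
lah : ℕ → ℕ → ℕ
lah n k = (n ! ℕ./ k !) ℕ.* ((n ∸ 1) C (k ∸ 1))
  where instance _ = k !≢0

signℚ : ℕ → ℚ
signℚ zero    = ℚ.1ℚ
signℚ (suc k) = ℚ.- signℚ k

lahRHS : ℕ → ℚ
lahRHS n = sum1to n (λ k →
  signℚ (suc k) * (+ lah n k ℚ./ 1) * ((+ (k !)) ℚ./ (2 ℕ.+ 3 ℕ.* k ℕ.+ k ℕ.* k)))

{-# OPTIONS --safe #-}

-- The hockey-stick identity (k+2) Σ_{x<q} x^(k+1) = (q-1) q (q+1) ⋯ (q+k) shows that the
-- q-th Riemann sum of x^(k+1) differs from -k!/(k+2) by q times an integer over k+2.  For
-- q = p^N this error is p-adically small, so Y₂(k+1) = -k!/(k+2); limits are unique because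
-- a rational whose numerator is divisible by every power of p is 0.  Hence for n = m+1 the
-- left side is (m+1)!/(m+2) - (m+1)!/(m+3) = (m+1)!/((m+2)(m+3)).  On the right,
-- |L(n,k)| k! = n! C(n-1,k-1) turns the sum into n! Σ_j (-1)^j C(m,j) / ((j+2)(j+3)), and
-- Σ_j (-1)^j C(m,j) / (j+c+1)^(r) = r^(m) / (c+1)^(r+m) follows by induction on m from
-- Pascal's rule and 1/x^(r) - 1/(x+1)^(r) = r / x^(r+1).
module Submission where

module PrimePowers where

  open import Data.Nat
  open import Data.Nat.Properties
  open import Data.Nat.Divisibility
  open import Data.Nat.Primality
  open import Data.Sum using (inj₁; inj₂)
  open import Relation.Nullary using (¬_; yes; no; contradiction)
  open import Relation.Binary.PropositionalEquality

  ^-monoʳ-∣ : ∀ m {n o} → n ≤ o → m ^ n ∣ m ^ o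
  ^-monoʳ-∣ m {n} {o} n≤o = subst (m ^ n ∣_) m^n*m^[o∸n]≡m^o (m∣m*n (m ^ (o ∸ n)))
    where
    m^n*m^[o∸n]≡m^o : m ^ n * m ^ (o ∸ n) ≡ m ^ o
    m^n*m^[o∸n]≡m^o = trans (sym (^-distribˡ-+-* m n (o ∸ n))) (cong (m ^_) (m+[n∸m]≡n n≤o))

  n<m^n : ∀ {m} → 1 < m → ∀ n → n < m ^ n
  n<m^n 1<m zero = s≤s z≤n
  n<m^n {m} 1<m (suc n) = begin-strict
      suc n          ≤⟨ n<m^n 1<m n ⟩
      m ^ n          <⟨ m<m+n (m ^ n) (<-≤-trans z<s (n<m^n 1<m n)) ⟩
      m ^ n + m ^ n  ≡⟨ cong (m ^ n +_) (sym (+-identityʳ (m ^ n))) ⟩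
      2 * m ^ n      ≤⟨ *-monoˡ-≤ (m ^ n) 1<m ⟩
      m * m ^ n      ∎
    where open ≤-Reasoning

  module _ {p : ℕ} (pp : Prime p) where
    private instance _ = prime⇒nonZero pp

    p^e∣a*d⇒p^e∣a : ∀ e {a d} → ¬ p ∣ d → p ^ e ∣ a * d → p ^ e ∣ a
    p^e∣a*d⇒p^e∣a zero    {a}     _   _ = 1∣ a
    p^e∣a*d⇒p^e∣a (suc e) {a} {d} p∤d p^[1+e]∣a*d
      with euclidsLemma a d pp (m*n∣⇒m∣ p (p ^ e) p^[1+e]∣a*d)
    ... | inj₂ p∣d = contradiction p∣d p∤d
    ... | inj₁ (divides a′ refl) =
      subst (p * p ^ e ∣_) (*-comm p a′) (*-monoʳ-∣ p (p^e∣a*d⇒p^e∣a e p∤d p^e∣a′*d))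
      where
      p^e∣a′*d : p ^ e ∣ a′ * d
      p^e∣a′*d = *-cancelˡ-∣ p (subst (p * p ^ e ∣_) a′*p*d≡ p^[1+e]∣a*d)
        where
        a′*p*d≡ : a′ * p * d ≡ p * (a′ * d)
        a′*p*d≡ = trans (cong (_* d) (*-comm a′ p)) (*-assoc p a′ d)

    -- A factor d < p ^ k carries fewer than k factors of p.
    p^[M+k]∣a*d⇒p^M∣a : ∀ M k {a d} → 0 < d → d < p ^ k → p ^ (M + k) ∣ a * d → p ^ M ∣ a
    p^[M+k]∣a*d⇒p^M∣a M zero    (s≤s z≤n) (s≤s ())
    p^[M+k]∣a*d⇒p^M∣a M (suc k) {a} {d} 0<d d<p^[1+k] p^[M+1+k]∣a*d with p ∣? d
    ... | no p∤d =
      ∣-trans (^-monoʳ-∣ p (m≤m+n M (suc k))) (p^e∣a*d⇒p^e∣a (M + suc k) p∤d p^[M+1+k]∣a*d)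
    ... | yes (divides zero refl) = contradiction 0<d (<-irrefl refl)
    ... | yes (divides d′@(suc _) refl) =
      p^[M+k]∣a*d⇒p^M∣a M k z<s d′<p^k (*-cancelˡ-∣ p (subst₂ _∣_ p^[M+1+k]≡ a*d≡ p^[M+1+k]∣a*d))
      where
      d′<p^k : d′ < p ^ k
      d′<p^k = *-cancelʳ-< p d′ (p ^ k) (subst (d′ * p <_) (*-comm p (p ^ k)) d<p^[1+k])
      p^[M+1+k]≡ : p ^ (M + suc k) ≡ p * p ^ (M + k)
      p^[M+1+k]≡ = cong (p ^_) (+-suc M k)
      a*d≡ : a * (d′ * p) ≡ p * (a * d′)
      a*d≡ = trans (sym (*-assoc a d′ p)) (*-comm (a * d′) p)

module Fractions where

  open import Data.Nat as ℕ using (ℕ; suc; NonZero)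
  import Data.Nat.Properties as ℕₚ
  open import Data.Integer as ℤ using (+_)
  import Data.Integer.Properties as ℤₚ
  open import Data.Integer.GCD using (gcd)
  open import Data.Integer.Tactic.RingSolver using (solve-∀)
  open import Data.Rational using (ℚ; _/_; _+_; _-_; _*_; -_; ↥_; ↧_; toℚᵘ)
  open import Data.Rational.Properties
  open import Data.Rational.Unnormalised using (mkℚᵘ; *≡*) renaming (_≃_ to _≃ᵘ_)
  import Data.Rational.Unnormalised.Properties as ℚᵘₚ
  open import Relation.Binary.PropositionalEquality
  open ≡-Reasoning

  private
    toℚᵘ-/ : ∀ a b → toℚᵘ (a / suc b) ≃ᵘ mkℚᵘ a b
    toℚᵘ-/ a b = toℚᵘ-fromℚᵘ (mkℚᵘ a b)

  /≡/ : ∀ a b c d .{{_ : NonZero b}} .{{_ : NonZero d}} → a ℤ.* + d ≡ c ℤ.* + b → a / b ≡ c / d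
  /≡/ a (suc b) c (suc d) eq = fromℚᵘ-cong {mkℚᵘ a b} {mkℚᵘ c d} (*≡* eq)

  +/≡+/ : ∀ a b c d .{{_ : NonZero b}} .{{_ : NonZero d}} → a ℕ.* d ≡ c ℕ.* b → + a / b ≡ + c / d
  +/≡+/ a b c d eq = /≡/ (+ a) b (+ c) d (begin
    + a ℤ.* + d  ≡⟨ ℤₚ.pos-* a d ⟨
    + (a ℕ.* d)  ≡⟨ cong +_ eq ⟩
    + (c ℕ.* b)  ≡⟨ ℤₚ.pos-* c b ⟩
    + c ℤ.* + b  ∎)

  /+/ : ∀ a b c d .{{_ : NonZero b}} .{{_ : NonZero d}} →
        a / b + c / d ≡ _/_ (a ℤ.* + d ℤ.+ c ℤ.* + b) (b ℕ.* d) {{ℕₚ.m*n≢0 b d}}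
  /+/ a (suc b) c (suc d) = toℚᵘ-injective (ℚᵘₚ.≃-trans (toℚᵘ-homo-+ (a / suc b) (c / suc d))
    (ℚᵘₚ.≃-trans (ℚᵘₚ.+-cong (toℚᵘ-/ a b) (toℚᵘ-/ c d)) (ℚᵘₚ.≃-sym (toℚᵘ-fromℚᵘ _))))

  /*/ : ∀ a b c d .{{_ : NonZero b}} .{{_ : NonZero d}} →
        (a / b) * (c / d) ≡ _/_ (a ℤ.* c) (b ℕ.* d) {{ℕₚ.m*n≢0 b d}}
  /*/ a (suc b) c (suc d) = toℚᵘ-injective (ℚᵘₚ.≃-trans (toℚᵘ-homo-* (a / suc b) (c / suc d))
    (ℚᵘₚ.≃-trans (ℚᵘₚ.*-cong (toℚᵘ-/ a b) (toℚᵘ-/ c d)) (ℚᵘₚ.≃-sym (toℚᵘ-fromℚᵘ _))))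

  -/ : ∀ a b .{{_ : NonZero b}} → - (a / b) ≡ (ℤ.- a) / b
  -/ a (suc b) = toℚᵘ-injective (ℚᵘₚ.≃-trans (toℚᵘ-homo‿- (a / suc b))
    (ℚᵘₚ.≃-trans (ℚᵘₚ.-‿cong (toℚᵘ-/ a b)) (ℚᵘₚ.≃-sym (toℚᵘ-fromℚᵘ _))))

  +/++/ : ∀ a b c d .{{_ : NonZero b}} .{{_ : NonZero d}} →
          + a / b + + c / d ≡ _/_ (+ (a ℕ.* d ℕ.+ c ℕ.* b)) (b ℕ.* d) {{ℕₚ.m*n≢0 b d}}
  +/++/ a b c d = trans (/+/ (+ a) b (+ c) d) (/-cong {{ℕₚ.m*n≢0 b d}} {{ℕₚ.m*n≢0 b d}} numerator refl)
    where
    numerator : + a ℤ.* + d ℤ.+ + c ℤ.* + b ≡ + (a ℕ.* d ℕ.+ c ℕ.* b)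
    numerator = trans (sym (cong₂ ℤ._+_ (ℤₚ.pos-* a d) (ℤₚ.pos-* c b))) (sym (ℤₚ.pos-+ (a ℕ.* d) (c ℕ.* b)))

  ι : ℕ → ℚ
  ι n = + n / 1

  ι*+/ : ∀ a b d .{{_ : NonZero d}} → ι a * (+ b / d) ≡ + (a ℕ.* b) / d
  ι*+/ a b d = trans (/*/ (+ a) 1 (+ b) d) (/-cong {{ℕₚ.m*n≢0 1 d}} (sym (ℤₚ.pos-* a b)) (ℕₚ.*-identityˡ d))

  ι-+ : ∀ m n → ι (m ℕ.+ n) ≡ ι m + ι n
  ι-+ m n = sym (begin
      ι m + ι n                                ≡⟨ /+/ (+ m) 1 (+ n) 1 ⟩
      (+ m ℤ.* + 1 ℤ.+ + n ℤ.* + 1) / 1         ≡⟨ cong (_/ 1) (unit (+ m) (+ n)) ⟩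
      (+ m ℤ.+ + n) / 1                         ≡⟨ cong (_/ 1) (ℤₚ.pos-+ m n) ⟨
      ι (m ℕ.+ n)                               ∎)
    where
    unit : ∀ a b → a ℤ.* + 1 ℤ.+ b ℤ.* + 1 ≡ a ℤ.+ b
    unit = solve-∀

  ι-* : ∀ m n → ι (m ℕ.* n) ≡ ι m * ι n
  ι-* m n = sym (ι*+/ m n 1)

  +/-+/suc : ∀ a n → + a / suc n - + a / suc (suc n) ≡ + a / (suc n ℕ.* suc (suc n))
  +/-+/suc a n = begin
      + a / suc n + - (+ a / suc (suc n))                        ≡⟨ cong (λ z → + a / suc n + z) (-/ (+ a) (suc (suc n))) ⟩
      + a / suc n + (ℤ.- + a) / suc (suc n)                      ≡⟨ /+/ (+ a) (suc n) (ℤ.- + a) (suc (suc n)) ⟩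
      (+ a ℤ.* + suc (suc n) ℤ.+ ℤ.- + a ℤ.* + suc n) / (suc n ℕ.* suc (suc n))
        ≡⟨ cong (_/ (suc n ℕ.* suc (suc n))) (telescope (+ a) (+ suc n)) ⟩
      + a / (suc n ℕ.* suc (suc n))                              ∎
    where
    telescope : ∀ a n → a ℤ.* (ℤ.1ℤ ℤ.+ n) ℤ.+ ℤ.- a ℤ.* n ≡ a
    telescope = solve-∀

  ↥[a/b]*b≡a*↧[a/b] : ∀ a b .{{_ : NonZero b}} → ↥ (a / b) ℤ.* + b ≡ a ℤ.* ↧ (a / b)
  ↥[a/b]*b≡a*↧[a/b] a b = begin
      ↥ q ℤ.* + b            ≡⟨ cong (↥ q ℤ.*_) (↧-/ a b) ⟨
      ↥ q ℤ.* (↧ q ℤ.* g)    ≡⟨ rearrange (↥ q) (↧ q) g ⟩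
      (↥ q ℤ.* g) ℤ.* ↧ q    ≡⟨ cong (ℤ._* ↧ q) (↥-/ a b) ⟩
      a ℤ.* ↧ q              ∎
    where
    q = a / b
    g = gcd a (+ b)
    rearrange : ∀ x y z → x ℤ.* (y ℤ.* z) ≡ (x ℤ.* z) ℤ.* y
    rearrange = solve-∀

module PAdic where

  open import Defs using (pSmall; VolkenbornIntegral; riemann; sumBelow)
  open PrimePowers
  open Fractions
  open import Data.Nat as ℕ using (ℕ; zero; suc; NonZero; _^_)
  import Data.Nat.Properties as ℕₚ
  open import Data.Nat.Divisibility using (_∣_; 1∣_; ∣-trans; ∣m⇒∣m*n; ∣⇒≤; m∣m*n)
  import Data.Nat.Coprimality as Coprimality
  open import Data.Nat.Primality using (Prime; prime⇒nonZero; prime⇒nonTrivial; euclidsLemma)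
  open import Data.Integer as ℤ using (+_)
  import Data.Integer.Properties as ℤₚ
  import Data.Integer.Divisibility.Signed as ℤ∣
  open import Data.Rational using (mkℚ; _/_; _+_; _-_; -_; ↥_; ↧_; ↧ₙ_; 0ℚ)
  open import Data.Rational.Properties using (↥p≡0⇒p≡0; ↥-neg)
  open import Data.Rational.Solver using (module +-*-Solver)
  open +-*-Solver using (solve; _:=_; _:+_; _:-_; con)
  open import Data.Product using (∃-syntax; _,_; proj₁; proj₂)
  open import Data.Sum using (inj₁; inj₂)
  open import Relation.Nullary using (¬_; contradiction)
  open import Relation.Binary.PropositionalEquality
  open ≡-Reasoning

  module _ {p : ℕ} (pp : Prime p) where
    private instance _ = prime⇒nonZero pp

    1<p : 1 ℕ.< p
    1<p = ℕ.nonTrivial⇒n>1 p {{prime⇒nonTrivial pp}}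

    pSmall-+/ : ∀ M X d .{{_ : NonZero d}} → p ^ (M ℕ.+ d) ∣ X → pSmall p M (+ X / d)
    pSmall-+/ M X d p^[M+d]∣X =
      p^[M+k]∣a*d⇒p^M∣a pp M d (ℕ.>-nonZero⁻¹ d) (n<m^n 1<p d)
        (subst (p ^ (M ℕ.+ d) ∣_) (sym num*d≡X*den) (∣m⇒∣m*n ℤ.∣ ↧ r ∣ p^[M+d]∣X))
      where
      r = + X / d
      num*d≡X*den : ℤ.∣ ↥ r ∣ ℕ.* d ≡ X ℕ.* ℤ.∣ ↧ r ∣
      num*d≡X*den = begin
        ℤ.∣ ↥ r ∣ ℕ.* d        ≡⟨ ℤₚ.abs-* (↥ r) (+ d) ⟨
        ℤ.∣ ↥ r ℤ.* + d ∣      ≡⟨ cong ℤ.∣_∣ (↥[a/b]*b≡a*↧[a/b] (+ X) d) ⟩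
        ℤ.∣ + X ℤ.* ↧ r ∣      ≡⟨ ℤₚ.abs-* (+ X) (↧ r) ⟩
        X ℕ.* ℤ.∣ ↧ r ∣        ∎

    pSmall-neg : ∀ M x → pSmall p M x → pSmall p M (- x)
    pSmall-neg M x = subst (p ^ M ∣_) (sym (trans (cong ℤ.∣_∣ (↥-neg x)) (ℤₚ.∣-i∣≡∣i∣ (↥ x))))

    p∣↥⇒p∤↧ : ∀ x → p ∣ ℤ.∣ ↥ x ∣ → ¬ p ∣ ↧ₙ x
    p∣↥⇒p∤↧ (mkℚ _ _ coprime) p∣↥ p∣↧ =
      ℕₚ.<-irrefl refl (subst (1 ℕ.<_) (Coprimality.recompute coprime (p∣↥ , p∣↧)) 1<p)

    pSmall-+ : ∀ M x y → pSmall p M x → pSmall p M y → pSmall p M (x + y)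
    pSmall-+ zero    x         y         _  _  = 1∣ _
    pSmall-+ M@(suc _) x@record{} y@record{} p^M∣x p^M∣y =
      p^e∣a*d⇒p^e∣a pp M p∤D (subst (p ^ M ∣_) num*D≡Z*den (∣m⇒∣m*n ℤ.∣ ↧ (x + y) ∣ p^M∣Z))
      where
      D = ↧ₙ x ℕ.* ↧ₙ y
      Z = ↥ x ℤ.* ↧ y ℤ.+ ↥ y ℤ.* ↧ x
      p^M∣Z : p ^ M ∣ ℤ.∣ Z ∣
      p^M∣Z = ℤ∣.∣⇒∣ᵤ {+ p ^ M} {Z} (ℤ∣.∣m∣n⇒∣m+n
        (ℤ∣.∣m⇒∣m*n (↧ y) (ℤ∣.∣ᵤ⇒∣ {+ p ^ M} {↥ x} p^M∣x))
        (ℤ∣.∣m⇒∣m*n (↧ x) (ℤ∣.∣ᵤ⇒∣ {+ p ^ M} {↥ y} p^M∣y)))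
      num*D≡Z*den : ℤ.∣ Z ∣ ℕ.* ℤ.∣ ↧ (x + y) ∣ ≡ ℤ.∣ ↥ (x + y) ∣ ℕ.* D
      num*D≡Z*den = begin
        ℤ.∣ Z ∣ ℕ.* ℤ.∣ ↧ (x + y) ∣    ≡⟨ ℤₚ.abs-* Z (↧ (x + y)) ⟨
        ℤ.∣ Z ℤ.* ↧ (x + y) ∣          ≡⟨ cong ℤ.∣_∣ (↥[a/b]*b≡a*↧[a/b] Z D) ⟨
        ℤ.∣ ↥ (x + y) ℤ.* + D ∣        ≡⟨ ℤₚ.abs-* (↥ (x + y)) (+ D) ⟩
        ℤ.∣ ↥ (x + y) ∣ ℕ.* D          ∎
      p^M∣⇒p∣ : ∀ {n} → p ^ M ∣ n → p ∣ n
      p^M∣⇒p∣ = ∣-trans (m∣m*n _)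
      p∤D : ¬ p ∣ D
      p∤D p∣D with euclidsLemma (↧ₙ x) (↧ₙ y) pp p∣D
      ... | inj₁ p∣↧x = p∣↥⇒p∤↧ x (p^M∣⇒p∣ p^M∣x) p∣↧x
      ... | inj₂ p∣↧y = p∣↥⇒p∤↧ y (p^M∣⇒p∣ p^M∣y) p∣↧y

    pSmall-sub : ∀ M x y → pSmall p M x → pSmall p M y → pSmall p M (x - y)
    pSmall-sub M x y p^M∣x p^M∣y = pSmall-+ M x (- y) p^M∣x (pSmall-neg M y p^M∣y)

    pSmall-∀⇒≡0 : ∀ x → (∀ M → pSmall p M x) → x ≡ 0ℚ
    pSmall-∀⇒≡0 x small with ℤ.∣ ↥ x ∣ in ∣↥x∣≡
    ... | zero  = ↥p≡0⇒p≡0 x (ℤₚ.∣i∣≡0⇒i≡0 ∣↥x∣≡)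
    ... | suc u = contradiction (∣⇒≤ (small (suc u))) (ℕₚ.<⇒≱ (n<m^n 1<p (suc u)))

    volkenbornIntegral-unique : ∀ {f a b} →
      VolkenbornIntegral p pp f a → VolkenbornIntegral p pp f b → a ≡ b
    volkenbornIntegral-unique {f} {a} {b} ∫f≡a ∫f≡b = begin
        a            ≡⟨ solve 2 (λ a b → a := (a :- b) :+ b) refl a b ⟩
        (a - b) + b  ≡⟨ cong (_+ b) (pSmall-∀⇒≡0 (a - b) a-b-small) ⟩
        0ℚ + b       ≡⟨ solve 1 (λ b → con 0ℚ :+ b := b) refl b ⟩
        b            ∎
      where
      a-b-small : ∀ M → pSmall p M (a - b)
      a-b-small M = subst (pSmall p M) (solve 3 (λ s a b → (s :- b) :- (s :- a) := a :- b) refl S a b)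
                      (pSmall-sub M (S - b) (S - a) (proj₂ (∫f≡b M) N N₂≤N) (proj₂ (∫f≡a M) N N₁≤N))
        where
        N₁ = proj₁ (∫f≡a M)
        N₂ = proj₁ (∫f≡b M)
        N = N₁ ℕ.⊔ N₂
        N₁≤N = ℕₚ.m≤m⊔n N₁ N₂
        N₂≤N = ℕₚ.m≤n⊔m N₁ N₂
        S = riemann p pp f N

    volkenbornIntegral-intro : ∀ f L d .{{_ : NonZero d}} →
      (∀ q .{{_ : NonZero q}} → ∃[ W ] + sumBelow q f / q - L ≡ + (q ℕ.* W) / d) →
      VolkenbornIntegral p pp f L
    volkenbornIntegral-intro f L d error M = M ℕ.+ d , λ N M+d≤N →
      let instance _ = ℕₚ.m^n≢0 p N
          (W , error≡) = error (p ^ N)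
      in subst (pSmall p M) (sym error≡)
           (pSmall-+/ M (p ^ N ℕ.* W) d (∣-trans (^-monoʳ-∣ p M+d≤N) (m∣m*n W)))

module RisingFactorial where

  open import Defs using (rising; sumBelow)
  open import Data.Nat
  open import Data.Nat.Properties
  open import Data.Nat.Tactic.RingSolver using (solve-∀)
  open import Data.Product using (∃-syntax; _,_)
  open import Relation.Binary.PropositionalEquality
  open ≡-Reasoning

  rising-suc : ∀ x n → rising x (suc n) ≡ x * rising (suc x) n
  rising-suc x zero    = trans (*-identityˡ (x + 0)) (trans (+-identityʳ x) (sym (*-identityʳ x)))
  rising-suc x (suc n) = begin
      rising x (suc n) * (x + suc n)        ≡⟨ cong (_* (x + suc n)) (rising-suc x n) ⟩
      x * rising (suc x) n * (x + suc n)    ≡⟨ *-assoc x _ _ ⟩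
      x * (rising (suc x) n * (x + suc n))  ≡⟨ cong (λ y → x * (rising (suc x) n * y)) (+-suc x n) ⟩
      x * rising (suc x) (suc n)            ∎

  rising-1 : ∀ k → rising 1 k ≡ k !
  rising-1 zero    = refl
  rising-1 (suc k) = trans (cong (_* suc k) (rising-1 k)) (*-comm (k !) (suc k))

  sumBelow-rising : ∀ k m → (2 + k) * sumBelow (suc m) (λ x → rising x (suc k)) ≡ rising m (2 + k)
  sumBelow-rising k zero    = begin
      (2 + k) * rising 0 (suc k)   ≡⟨ cong ((2 + k) *_) (rising-suc 0 k) ⟩
      (2 + k) * 0                  ≡⟨ *-zeroʳ (2 + k) ⟩
      0                            ≡⟨ rising-suc 0 (suc k) ⟨
      rising 0 (2 + k)             ∎
  sumBelow-rising k (suc m) = begin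
      (2 + k) * (S + R)                         ≡⟨ *-distribˡ-+ (2 + k) S R ⟩
      (2 + k) * S + (2 + k) * R                 ≡⟨ cong (_+ (2 + k) * R) (sumBelow-rising k m) ⟩
      rising m (2 + k) + (2 + k) * R            ≡⟨ cong (_+ (2 + k) * R) (rising-suc m (suc k)) ⟩
      m * R + (2 + k) * R                       ≡⟨ rearrange m k R ⟩
      R * (suc m + suc k)                       ∎
    where
    S = sumBelow (suc m) (λ x → rising x (suc k))
    R = rising (suc m) (suc k)
    rearrange : ∀ m k r → m * r + (2 + k) * r ≡ r * (suc m + suc k)
    rearrange = solve-∀

  rising-+-≡-mod : ∀ x d k → ∃[ t ] rising (x + d) k ≡ rising x k + d * t
  rising-+-≡-mod x d zero    = 0 , cong suc (sym (*-zeroʳ d))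
  rising-+-≡-mod x d (suc k) with rising-+-≡-mod x d k
  ... | t , eq = rising x k + t * (x + d + k) , (begin
      rising (x + d) k * (x + d + k)       ≡⟨ cong (_* (x + d + k)) eq ⟩
      (rising x k + d * t) * (x + d + k)   ≡⟨ expand x d k (rising x k) t ⟩
      rising x k * (x + k) + d * (rising x k + t * (x + d + k)) ∎)
    where
    expand : ∀ x d k r t → (r + d * t) * (x + d + k) ≡ r * (x + k) + d * (r + t * (x + d + k))
    expand = solve-∀

  -- (q-1) q (q+1) ⋯ (q+k) ≡ (q-1) q k! ≡ - q k!  (mod q²)
  sumBelow-rising-≡-mod : ∀ k m →
    ∃[ W ] (2 + k) * sumBelow (suc m) (λ x → rising x (suc k)) + suc m * k ! ≡ suc m * (suc m * W)
  sumBelow-rising-≡-mod k m with rising-+-≡-mod 1 (suc m) k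
  ... | t , eq = k ! + m * t , (begin
      (2 + k) * sumBelow (suc m) (λ x → rising x (suc k)) + q * k ! ≡⟨ cong (_+ q * k !) (sumBelow-rising k m) ⟩
      rising m (2 + k) + q * k !                ≡⟨ cong (_+ q * k !) (rising-suc m (suc k)) ⟩
      m * rising q (suc k) + q * k !            ≡⟨ cong (λ z → m * z + q * k !) (rising-suc q k) ⟩
      m * (q * rising (1 + q) k) + q * k !      ≡⟨ cong (λ z → m * (q * z) + q * k !) eq ⟩
      m * (q * (rising 1 k + q * t)) + q * k !  ≡⟨ cong (λ z → m * (q * (z + q * t)) + q * k !) (rising-1 k) ⟩
      m * (q * (k ! + q * t)) + q * k !         ≡⟨ collect m (k !) t ⟩
      q * (q * (k ! + m * t))                   ∎)
    where
    q = suc m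
    collect : ∀ m f t → m * (suc m * (f + suc m * t)) + suc m * f ≡ suc m * (suc m * (f + m * t))
    collect = solve-∀

module RisingIntegral where

  open import Defs using (rising; sumBelow; VolkenbornIntegral)
  open RisingFactorial
  open Fractions
  open PAdic using (volkenbornIntegral-intro)
  open import Data.Nat as ℕ using (ℕ; suc; NonZero; _!)
  import Data.Nat.Properties as ℕₚ
  open import Data.Nat.Primality using (Prime)
  open import Data.Nat.Tactic.RingSolver using (solve-∀)
  open import Data.Integer using (+_)
  open import Data.Rational using (ℚ; _/_; _+_; _-_; _*_; -_)
  open import Data.Rational.Solver using (module +-*-Solver)
  open +-*-Solver using (solve; _:=_; _:*_; :-_; _:-_)
  open import Data.Product using (∃-syntax; _,_)
  open import Relation.Binary.PropositionalEquality
  open ≡-Reasoning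

  risingIntegral : ℕ → ℚ
  risingIntegral k = - (+ (k !) / (2 ℕ.+ k))

  riemannError-rising : ∀ k q .{{_ : NonZero q}} →
    ∃[ W ] + sumBelow q (λ x → rising x (suc k)) / q - risingIntegral k ≡ + (q ℕ.* W) / (2 ℕ.+ k)
  riemannError-rising k q@(suc m) with sumBelow-rising-≡-mod k m
  ... | W , eq = W , (begin
      + s / q - risingIntegral k   ≡⟨ cong (λ z → + s / q + z) (solve 1 (λ x → :- (:- x) := x) refl (+ (k !) / d)) ⟩
      + s / q + + (k !) / d        ≡⟨ +/++/ s q (k !) d ⟩
      + n / (q ℕ.* d)              ≡⟨ +/≡+/ n (q ℕ.* d) (q ℕ.* W) d cross ⟩
      + (q ℕ.* W) / d              ∎)
    where
    d = 2 ℕ.+ k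
    s = sumBelow q (λ x → rising x (suc k))
    n = s ℕ.* d ℕ.+ k ! ℕ.* q
    cross : n ℕ.* d ≡ q ℕ.* W ℕ.* (q ℕ.* d)
    cross = begin
      (s ℕ.* d ℕ.+ k ! ℕ.* q) ℕ.* d  ≡⟨ cong (ℕ._* d) (cong₂ ℕ._+_ (ℕₚ.*-comm s d) (ℕₚ.*-comm (k !) q)) ⟩
      (d ℕ.* s ℕ.+ q ℕ.* k !) ℕ.* d  ≡⟨ cong (ℕ._* d) eq ⟩
      q ℕ.* (q ℕ.* W) ℕ.* d          ≡⟨ rearrange q W d ⟩
      q ℕ.* W ℕ.* (q ℕ.* d)          ∎
      where
      rearrange : ∀ a b c → a ℕ.* (a ℕ.* b) ℕ.* c ≡ a ℕ.* b ℕ.* (a ℕ.* c)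
      rearrange = solve-∀

  volkenbornIntegral-rising : ∀ {p} (pp : Prime p) k →
    VolkenbornIntegral p pp (λ x → rising x (suc k)) (risingIntegral k)
  volkenbornIntegral-rising pp k = volkenbornIntegral-intro pp _ _ (2 ℕ.+ k) (riemannError-rising k)

  risingIntegral-difference : ∀ m →
    risingIntegral (suc m) - ι (suc m) * risingIntegral m ≡ + (suc m !) / ((2 ℕ.+ m) ℕ.* (3 ℕ.+ m))
  risingIntegral-difference m = begin
      - (+ N / (3 ℕ.+ m)) - ι (suc m) * - (+ (m !) / (2 ℕ.+ m))
        ≡⟨ solve 3 (λ x i z → :- x :- i :* :- z := i :* z :- x) refl (+ N / (3 ℕ.+ m)) (ι (suc m)) (+ (m !) / (2 ℕ.+ m)) ⟩
      ι (suc m) * (+ (m !) / (2 ℕ.+ m)) - + N / (3 ℕ.+ m)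
        ≡⟨ cong (_- + N / (3 ℕ.+ m)) (ι*+/ (suc m) (m !) (2 ℕ.+ m)) ⟩
      + N / (2 ℕ.+ m) - + N / (3 ℕ.+ m)
        ≡⟨ +/-+/suc N (suc m) ⟩
      + N / ((2 ℕ.+ m) ℕ.* (3 ℕ.+ m)) ∎
    where N = suc m !

module AlternatingBinomialSums where

  open import Defs using (rising; signℚ)
  open RisingFactorial using (rising-suc)
  open Fractions
  open import Data.Nat as ℕ using (ℕ; zero; suc; NonZero; _<_)
  import Data.Nat.Properties as ℕₚ
  open import Data.Nat.Combinatorics using (_C_; nCk+nC[k+1]≡[n+1]C[k+1]; nCk≡nC[n∸k]; nCn≡1)
  open import Data.Nat.Combinatorics.Specification using (k>n⇒nCk≡0)
  open import Data.Integer as ℤ using (+_)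
  import Data.Integer.Properties as ℤₚ
  open import Data.Integer.Tactic.RingSolver using (solve-∀)
  open import Data.Rational using (ℚ; _/_; _+_; _-_; _*_; -_; 0ℚ; 1ℚ)
  open import Data.Rational.Solver using (module +-*-Solver)
  open +-*-Solver using (solve; _:=_; _:+_; _:*_; :-_; _:-_; con)
  open import Relation.Binary.PropositionalEquality
  open ≡-Reasoning

  Σ< : ℕ → (ℕ → ℚ) → ℚ
  Σ< zero    f = 0ℚ
  Σ< (suc n) f = Σ< n f + f n

  Σ<-cong : ∀ n {f g} → (∀ j → j < n → f j ≡ g j) → Σ< n f ≡ Σ< n g
  Σ<-cong zero    f≗g = refl
  Σ<-cong (suc n) f≗g = cong₂ _+_ (Σ<-cong n (λ j j<n → f≗g j (ℕₚ.m<n⇒m<1+n j<n))) (f≗g n (ℕₚ.n<1+n n))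

  Σ<-+ : ∀ n f g → Σ< n (λ j → f j + g j) ≡ Σ< n f + Σ< n g
  Σ<-+ zero    f g = refl
  Σ<-+ (suc n) f g = trans (cong (_+ (f n + g n)) (Σ<-+ n f g))
    (solve 4 (λ a b c d → (a :+ b) :+ (c :+ d) := (a :+ c) :+ (b :+ d)) refl (Σ< n f) (Σ< n g) (f n) (g n))

  Σ<-scale : ∀ n c f → Σ< n (λ j → c * f j) ≡ c * Σ< n f
  Σ<-scale zero    c f = solve 1 (λ c → con 0ℚ := c :* con 0ℚ) refl c
  Σ<-scale (suc n) c f = trans (cong (_+ (c * f n)) (Σ<-scale n c f))
    (solve 3 (λ c a b → c :* a :+ c :* b := c :* (a :+ b)) refl c (Σ< n f) (f n))

  Σ<-neg : ∀ n f → Σ< n (λ j → - f j) ≡ - Σ< n f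
  Σ<-neg zero    f = refl
  Σ<-neg (suc n) f = trans (cong (_+ (- f n)) (Σ<-neg n f))
    (solve 2 (λ a b → (:- a) :+ (:- b) := :- (a :+ b)) refl (Σ< n f) (f n))

  Σ<-suc : ∀ n f → Σ< (suc n) f ≡ f 0 + Σ< n (λ j → f (suc j))
  Σ<-suc zero    f = solve 1 (λ a → con 0ℚ :+ a := a :+ con 0ℚ) refl (f 0)
  Σ<-suc (suc n) f = trans (cong (_+ f (suc n)) (Σ<-suc n f))
    (solve 3 (λ a b c → (a :+ b) :+ c := a :+ (b :+ c)) refl (f 0) (Σ< n (λ j → f (suc j))) (f (suc n)))

  signedBinomial : ℕ → ℕ → ℚ
  signedBinomial m j = signℚ j * ι (m C j)

  signedBinomial-0 : ∀ m → signedBinomial m 0 ≡ 1ℚ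
  signedBinomial-0 m = cong (λ z → 1ℚ * ι z) (trans (nCk≡nC[n∸k] {0} {m} ℕ.z≤n) (nCn≡1 m))

  signedBinomial-suc-diag : ∀ m → signedBinomial m (suc m) ≡ 0ℚ
  signedBinomial-suc-diag m = trans (cong (λ z → signℚ (suc m) * ι z) (k>n⇒nCk≡0 (ℕₚ.n<1+n m)))
    (solve 1 (λ s → s :* con 0ℚ := con 0ℚ) refl (signℚ (suc m)))

  signedBinomial-pascal : ∀ m j → signedBinomial (suc m) (suc j) ≡ - signedBinomial m j + signedBinomial m (suc j)
  signedBinomial-pascal m j = begin
      - signℚ j * ι (suc m C suc j)                ≡⟨ cong (λ z → - signℚ j * ι z) (nCk+nC[k+1]≡[n+1]C[k+1] m j) ⟨
      - signℚ j * ι (m C j ℕ.+ m C suc j)          ≡⟨ cong (λ z → - signℚ j * z) (ι-+ (m C j) (m C suc j)) ⟩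
      - signℚ j * (ι (m C j) + ι (m C suc j))      ≡⟨ solve 3 (λ s u v → (:- s) :* (u :+ v) := :- (s :* u) :+ (:- s) :* v) refl
                                                        (signℚ j) (ι (m C j)) (ι (m C suc j)) ⟩
      - signedBinomial m j + signedBinomial m (suc j) ∎

  binomialTransform : ℕ → (ℕ → ℚ) → ℚ
  binomialTransform m g = Σ< (suc m) (λ j → signedBinomial m j * g j)

  binomialTransform-cong : ∀ m {f g} → (∀ j → f j ≡ g j) → binomialTransform m f ≡ binomialTransform m g
  binomialTransform-cong m f≗g = Σ<-cong (suc m) (λ j _ → cong (signedBinomial m j *_) (f≗g j))

  binomialTransform-scale : ∀ m c f → binomialTransform m (λ j → c * f j) ≡ c * binomialTransform m f
  binomialTransform-scale m c f = trans
    (Σ<-cong (suc m) (λ j _ → solve 3 (λ x y z → x :* (y :* z) := y :* (x :* z)) refl (signedBinomial m j) c (f j)))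
    (Σ<-scale (suc m) c (λ j → signedBinomial m j * f j))

  binomialTransform-suc : ∀ m g → binomialTransform (suc m) g ≡ binomialTransform m (λ j → g j - g (suc j))
  binomialTransform-suc m g = begin
      binomialTransform (suc m) g
        ≡⟨ Σ<-suc (suc m) _ ⟩
      signedBinomial (suc m) 0 * g 0 + Σ< (suc m) (λ j → signedBinomial (suc m) (suc j) * g (suc j))
        ≡⟨ cong₂ _+_ (cong (_* g 0) (signedBinomial-0 (suc m))) (Σ<-cong (suc m) (λ j _ → pascal j)) ⟩
      1ℚ * g 0 + Σ< (suc m) (λ j → - (a j * g (suc j)) + a (suc j) * g (suc j))
        ≡⟨ cong (λ z → 1ℚ * g 0 + z) (trans (Σ<-+ (suc m) _ _) (cong (_+ T) (Σ<-neg (suc m) _))) ⟩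
      1ℚ * g 0 + (- U + T)
        ≡⟨ cong (λ z → 1ℚ * g 0 + (- U + z)) T≡F-g0 ⟩
      1ℚ * g 0 + (- U + (F - g 0))
        ≡⟨ solve 3 (λ g0 u f → con 1ℚ :* g0 :+ (:- u :+ (f :- g0)) := f :+ :- u) refl (g 0) U F ⟩
      F + - U
        ≡⟨ cong (λ z → F + z) (Σ<-neg (suc m) _) ⟨
      F + Σ< (suc m) (λ j → - (a j * g (suc j)))
        ≡⟨ Σ<-+ (suc m) _ _ ⟨
      Σ< (suc m) (λ j → a j * g j + - (a j * g (suc j)))
        ≡⟨ Σ<-cong (suc m) (λ j _ → solve 3 (λ x y z → x :* y :+ :- (x :* z) := x :* (y :- z)) refl (a j) (g j) (g (suc j))) ⟩
      binomialTransform m (λ j → g j - g (suc j)) ∎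
    where
    a = signedBinomial m
    F = binomialTransform m g
    U = Σ< (suc m) (λ j → a j * g (suc j))
    T = Σ< (suc m) (λ j → a (suc j) * g (suc j))
    pascal : ∀ j → signedBinomial (suc m) (suc j) * g (suc j) ≡ - (a j * g (suc j)) + a (suc j) * g (suc j)
    pascal j = trans (cong (_* g (suc j)) (signedBinomial-pascal m j))
      (solve 3 (λ x y z → (:- x :+ y) :* z := :- (x :* z) :+ y :* z) refl (a j) (a (suc j)) (g (suc j)))
    T≡F-g0 : T ≡ F - g 0
    T≡F-g0 = begin
      T                                    ≡⟨ solve 2 (λ t g0 → t := (con 1ℚ :* g0 :+ t) :- g0) refl T (g 0) ⟩
      (1ℚ * g 0 + T) - g 0                 ≡⟨ cong (λ z → (z * g 0 + T) - g 0) (signedBinomial-0 m) ⟨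
      (a 0 * g 0 + T) - g 0                ≡⟨ cong (_- g 0) (Σ<-suc (suc m) (λ j → a j * g j)) ⟨
      (F + a (suc m) * g (suc m)) - g 0    ≡⟨ cong (λ z → (F + z * g (suc m)) - g 0) (signedBinomial-suc-diag m) ⟩
      (F + 0ℚ * g (suc m)) - g 0           ≡⟨ solve 3 (λ f x g0 → (f :+ con 0ℚ :* x) :- g0 := f :- g0) refl F (g (suc m)) (g 0) ⟩
      F - g 0                              ∎

  rising-nonZero : ∀ x r → NonZero (rising (suc x) r)
  rising-nonZero x zero    = _
  rising-nonZero x (suc r) = ℕₚ.m*n≢0 (rising (suc x) r) (suc x ℕ.+ r) {{rising-nonZero x r}}

  1/rising : ℕ → ℕ → ℚ
  1/rising x r = _/_ (+ 1) (rising (suc x) r) {{rising-nonZero x r}}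

  1/rising-difference : ∀ x r → 1/rising x r - 1/rising (suc x) r ≡ ι r * 1/rising x (suc r)
  1/rising-difference x r = begin
      + 1 / A + - (+ 1 / B)                                 ≡⟨ cong (λ z → + 1 / A + z) (-/ (+ 1) B) ⟩
      + 1 / A + ℤ.-1ℤ / B                                   ≡⟨ /+/ (+ 1) A ℤ.-1ℤ B ⟩
      _/_ (+ 1 ℤ.* + B ℤ.+ ℤ.-1ℤ ℤ.* + A) (A ℕ.* B) {{ℕₚ.m*n≢0 A B}}
        ≡⟨ /≡/ (+ 1 ℤ.* + B ℤ.+ ℤ.-1ℤ ℤ.* + A) (A ℕ.* B) (+ (r ℕ.* 1)) A⁺ {{ℕₚ.m*n≢0 A B}} cross ⟩
      + (r ℕ.* 1) / A⁺                                      ≡⟨ ι*+/ r 1 A⁺ ⟨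
      ι r * (+ 1 / A⁺)                                      ∎
    where
    A = rising (suc x) r
    B = rising (2 ℕ.+ x) r
    A⁺ = rising (suc x) (suc r)
    instance
      _ = rising-nonZero x r
      _ = rising-nonZero (suc x) r
      _ = rising-nonZero x (suc r)
    A⁺≡A*[1+x+r] : + A⁺ ≡ + A ℤ.* (+ suc x ℤ.+ + r)
    A⁺≡A*[1+x+r] = ℤₚ.pos-* A (suc x ℕ.+ r)
    A⁺≡[1+x]*B : + A⁺ ≡ + suc x ℤ.* + B
    A⁺≡[1+x]*B = trans (cong +_ (rising-suc (suc x) r)) (ℤₚ.pos-* (suc x) B)
    cross : (+ 1 ℤ.* + B ℤ.+ ℤ.-1ℤ ℤ.* + A) ℤ.* + A⁺ ≡ + (r ℕ.* 1) ℤ.* + (A ℕ.* B)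
    cross = begin
      (+ 1 ℤ.* + B ℤ.+ ℤ.-1ℤ ℤ.* + A) ℤ.* + A⁺              ≡⟨ expand (+ A) (+ B) (+ A⁺) ⟩
      + B ℤ.* + A⁺ ℤ.- + A ℤ.* + A⁺                           ≡⟨ cong₂ (λ u v → + B ℤ.* u ℤ.- + A ℤ.* v) A⁺≡A*[1+x+r] A⁺≡[1+x]*B ⟩
      + B ℤ.* (+ A ℤ.* (+ suc x ℤ.+ + r)) ℤ.- + A ℤ.* (+ suc x ℤ.* + B)
                                                            ≡⟨ cancel (+ A) (+ B) (+ suc x) (+ r) ⟩
      + r ℤ.* + 1 ℤ.* (+ A ℤ.* + B)                         ≡⟨ cong₂ ℤ._*_ (ℤₚ.pos-* r 1) (ℤₚ.pos-* A B) ⟨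
      + (r ℕ.* 1) ℤ.* + (A ℕ.* B)                           ∎
      where
      expand : ∀ a b c → (+ 1 ℤ.* b ℤ.+ ℤ.-1ℤ ℤ.* a) ℤ.* c ≡ b ℤ.* c ℤ.- a ℤ.* c
      expand = solve-∀
      cancel : ∀ a b x r → b ℤ.* (a ℤ.* (x ℤ.+ r)) ℤ.- a ℤ.* (x ℤ.* b) ≡ r ℤ.* + 1 ℤ.* (a ℤ.* b)
      cancel = solve-∀

  binomialTransform-1/rising : ∀ c m r →
    binomialTransform m (λ j → 1/rising (j ℕ.+ c) r) ≡ ι (rising r m) * 1/rising c (r ℕ.+ m)
  binomialTransform-1/rising c zero r = begin
      0ℚ + signedBinomial 0 0 * 1/rising c r   ≡⟨ cong (λ z → 0ℚ + z * 1/rising c r) (signedBinomial-0 0) ⟩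
      0ℚ + 1ℚ * 1/rising c r                   ≡⟨ solve 1 (λ x → con 0ℚ :+ con 1ℚ :* x := con 1ℚ :* x) refl (1/rising c r) ⟩
      1ℚ * 1/rising c r                        ≡⟨ cong (λ n → 1ℚ * 1/rising c n) (ℕₚ.+-identityʳ r) ⟨
      ι (rising r 0) * 1/rising c (r ℕ.+ 0)    ∎
  binomialTransform-1/rising c (suc m) r = begin
      binomialTransform (suc m) (λ j → 1/rising (j ℕ.+ c) r)
        ≡⟨ binomialTransform-suc m _ ⟩
      binomialTransform m (λ j → 1/rising (j ℕ.+ c) r - 1/rising (suc j ℕ.+ c) r)
        ≡⟨ binomialTransform-cong m (λ j → 1/rising-difference (j ℕ.+ c) r) ⟩
      binomialTransform m (λ j → ι r * 1/rising (j ℕ.+ c) (suc r))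
        ≡⟨ binomialTransform-scale m (ι r) _ ⟩
      ι r * binomialTransform m (λ j → 1/rising (j ℕ.+ c) (suc r))
        ≡⟨ cong (ι r *_) (binomialTransform-1/rising c m (suc r)) ⟩
      ι r * (ι (rising (suc r) m) * 1/rising c (suc r ℕ.+ m))
        ≡⟨ solve 3 (λ x y z → x :* (y :* z) := (x :* y) :* z) refl (ι r) (ι (rising (suc r) m)) (1/rising c (suc r ℕ.+ m)) ⟩
      ι r * ι (rising (suc r) m) * 1/rising c (suc r ℕ.+ m)
        ≡⟨ cong₂ (λ u v → u * 1/rising c v) (sym (ι-* r (rising (suc r) m))) (sym (ℕₚ.+-suc r m)) ⟩
      ι (r ℕ.* rising (suc r) m) * 1/rising c (r ℕ.+ suc m)
        ≡⟨ cong (λ u → ι u * 1/rising c (r ℕ.+ suc m)) (rising-suc r m) ⟨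
      ι (rising r (suc m)) * 1/rising c (r ℕ.+ suc m) ∎

module LahSum where

  open import Defs using (lah; lahRHS; sum1to; signℚ; rising)
  open Fractions
  open AlternatingBinomialSums
  open import Data.Nat as ℕ using (ℕ; zero; suc; _≤_; _!)
  import Data.Nat.Properties as ℕₚ
  open ℕₚ using (_!≢0)
  open import Data.Nat.Combinatorics using (_C_)
  open import Data.Nat.DivMod using (m/n*n≡m)
  open import Data.Nat.Divisibility using (m≤n⇒m!∣n!)
  open import Data.Nat.Tactic.RingSolver using (solve-∀)
  open import Data.Integer using (+_)
  open import Data.Rational using (ℚ; _/_; _+_; _*_; -_)
  open import Data.Rational.Properties using (/-cong)
  open import Data.Rational.Solver using (module +-*-Solver)
  open +-*-Solver using (solve; _:=_; _:*_; :-_)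
  open import Relation.Binary.PropositionalEquality
  open ≡-Reasoning

  lahSummand : ℕ → ℕ → ℚ
  lahSummand n k = signℚ (suc k) * (+ lah n k / 1) * (+ (k !) / (2 ℕ.+ 3 ℕ.* k ℕ.+ k ℕ.* k))

  sum1to-Σ< : ∀ n g → sum1to n g ≡ Σ< n (λ j → g (suc j))
  sum1to-Σ< zero    g = refl
  sum1to-Σ< (suc n) g = cong (_+ g (suc n)) (sum1to-Σ< n g)

  lah*!≡!*C : ∀ m j → j ≤ m → lah (suc m) (suc j) ℕ.* suc j ! ≡ suc m ! ℕ.* (m C j)
  lah*!≡!*C m j j≤m = begin
      q ℕ.* c ℕ.* K    ≡⟨ ℕₚ.*-assoc q c K ⟩
      q ℕ.* (c ℕ.* K)  ≡⟨ cong (q ℕ.*_) (ℕₚ.*-comm c K) ⟩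
      q ℕ.* (K ℕ.* c)  ≡⟨ ℕₚ.*-assoc q K c ⟨
      q ℕ.* K ℕ.* c    ≡⟨ cong (ℕ._* c) (m/n*n≡m {{suc j !≢0}} (m≤n⇒m!∣n! (ℕ.s≤s j≤m))) ⟩
      N ℕ.* c          ∎
    where
    N = suc m !
    K = suc j !
    c = m C j
    q = ℕ._/_ N K {{suc j !≢0}}

  lahSummand≡ : ∀ m j → j ≤ m →
    lahSummand (suc m) (suc j) ≡ ι (suc m !) * (signedBinomial m j * 1/rising (j ℕ.+ 1) 2)
  lahSummand≡ m j j≤m = begin
      - (- s) * ι L * (+ K / D)        ≡⟨ solve 3 (λ s l f → :- (:- s) :* l :* f := s :* (l :* f)) refl s (ι L) (+ K / D) ⟩
      s * (ι L * (+ K / D))            ≡⟨ cong (s *_) (ι*+/ L K D) ⟩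
      s * (+ (L ℕ.* K) / D)            ≡⟨ cong (s *_) (/-cong {{_}} {{nz}} (cong +_ (lah*!≡!*C m j j≤m)) (D≡ j)) ⟩
      s * (+ (N ℕ.* c) / D′)           ≡⟨ cong (s *_) (ι*+/ N c D′) ⟨
      s * (ι N * (+ c / D′))           ≡⟨ cong (λ z → s * (ι N * z)) (/-cong {{nz}} {{nz}} (cong +_ (ℕₚ.*-identityʳ c)) refl) ⟨
      s * (ι N * (+ (c ℕ.* 1) / D′))   ≡⟨ cong (λ z → s * (ι N * z)) (ι*+/ c 1 D′) ⟨
      s * (ι N * (ι c * 1/rising (j ℕ.+ 1) 2))
        ≡⟨ solve 4 (λ s n c x → s :* (n :* (c :* x)) := n :* (s :* c :* x)) refl s (ι N) (ι c) (1/rising (j ℕ.+ 1) 2) ⟩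
      ι N * (signedBinomial m j * 1/rising (j ℕ.+ 1) 2) ∎
    where
    s = signℚ j
    L = lah (suc m) (suc j)
    K = suc j !
    N = suc m !
    c = m C j
    D = 2 ℕ.+ 3 ℕ.* suc j ℕ.+ suc j ℕ.* suc j
    D′ = rising (suc (j ℕ.+ 1)) 2
    nz = rising-nonZero (j ℕ.+ 1) 2
    D≡ : ∀ j → 2 ℕ.+ 3 ℕ.* suc j ℕ.+ suc j ℕ.* suc j ≡ 1 ℕ.* (suc (j ℕ.+ 1) ℕ.+ 0) ℕ.* (suc (j ℕ.+ 1) ℕ.+ 1)
    D≡ = solve-∀

  lahRHS-closedForm : ∀ m → lahRHS (suc m) ≡ + (suc m !) / ((2 ℕ.+ m) ℕ.* (3 ℕ.+ m))
  lahRHS-closedForm m = begin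
      lahRHS (suc m)                                                   ≡⟨ sum1to-Σ< (suc m) (lahSummand (suc m)) ⟩
      Σ< (suc m) (λ j → lahSummand (suc m) (suc j))                    ≡⟨ Σ<-cong (suc m) (λ j j<1+m → lahSummand≡ m j (ℕₚ.≤-pred j<1+m)) ⟩
      Σ< (suc m) (λ j → ι N * (signedBinomial m j * 1/rising (j ℕ.+ 1) 2))  ≡⟨ Σ<-scale (suc m) (ι N) _ ⟩
      ι N * binomialTransform m (λ j → 1/rising (j ℕ.+ 1) 2)           ≡⟨ cong (ι N *_) (binomialTransform-1/rising 1 m 2) ⟩
      ι N * (ι R * 1/rising 1 (2 ℕ.+ m))                               ≡⟨ cong (ι N *_) (ι*+/ R 1 R′) ⟩
      ι N * (+ (R ℕ.* 1) / R′)                                          ≡⟨ ι*+/ N (R ℕ.* 1) R′ ⟩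
      + (N ℕ.* (R ℕ.* 1)) / R′                                          ≡⟨ +/≡+/ (N ℕ.* (R ℕ.* 1)) R′ N ((2 ℕ.+ m) ℕ.* (3 ℕ.+ m)) (cancel N R m) ⟩
      + N / ((2 ℕ.+ m) ℕ.* (3 ℕ.+ m))                                   ∎
    where
    N = suc m !
    R = rising 2 m
    R′ = rising 2 (2 ℕ.+ m)
    instance _ = rising-nonZero 1 (2 ℕ.+ m)
    cancel : ∀ n r m → n ℕ.* (r ℕ.* 1) ℕ.* ((2 ℕ.+ m) ℕ.* (3 ℕ.+ m)) ≡ n ℕ.* (r ℕ.* (2 ℕ.+ m) ℕ.* (2 ℕ.+ suc m))
    cancel = solve-∀

open import Defs
open import Data.Nat using (ℕ; suc; _≤_)
open import Data.Nat.Primality using (Prime)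
open import Data.Rational using (ℚ; _-_; _*_; _/_)
open import Data.Integer using (+_)
open import Data.Product using (_×_; ∃-syntax; _,_)
open import Relation.Binary.PropositionalEquality using (_≡_; cong₂; module ≡-Reasoning)
import Data.Nat as ℕ
open import Data.Nat using (_!)
open ≡-Reasoning
open PAdic using (volkenbornIntegral-unique)
open RisingIntegral using (risingIntegral; volkenbornIntegral-rising; risingIntegral-difference)
open LahSum using (lahRHS-closedForm)

mainTheorem5 : (p : ℕ) (pp : Prime p) (n : ℕ) → 1 ≤ n →
    (∃[ a ] VolkenbornIntegral p pp (λ x → rising x (suc n)) a)
    × (∃[ b ] VolkenbornIntegral p pp (λ x → rising x n) b)
    × (∀ (a b : ℚ) → VolkenbornIntegral p pp (λ x → rising x (suc n)) a
        → VolkenbornIntegral p pp (λ x → rising x n) b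
        → a - (+ n / 1) * b ≡ lahRHS n)
mainTheorem5 p pp (suc m) _ = (Y (suc m) , ∫Y (suc m)) , (Y m , ∫Y m) , λ a b ∫a ∫b → begin
    a - (+ suc m / 1) * b
      ≡⟨ cong₂ (λ u v → u - (+ suc m / 1) * v)
           (volkenbornIntegral-unique pp ∫a (∫Y (suc m))) (volkenbornIntegral-unique pp ∫b (∫Y m)) ⟩
    Y (suc m) - (+ suc m / 1) * Y m        ≡⟨ risingIntegral-difference m ⟩
    + (suc m !) / ((2 ℕ.+ m) ℕ.* (3 ℕ.+ m)) ≡⟨ lahRHS-closedForm m ⟨
    lahRHS (suc m)                         ∎
  where
  Y = risingIntegral
  ∫Y = volkenbornIntegral-rising pp
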